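{- For every nonnegative integer $j$, $$\liminf_{k\to\infty}\frac{\gamma_j(k)}{k}\ \ge\ \frac{1}{10}\qquad\text{and}\qquad \limsup_{k\to\infty}\frac{\gamma_j(k)}{k}\ \ge\ \frac{1}{5}.$$
   Context: The Thue–Morse word $\mathbf{t}=\mathbf{t}_1\mathbf{t}_2\mathbf{t}_3\cdots=0110100110010110\cdots$ is the infinite binary word whose $i$-th letter $\mathbf{t}_i$ ($i\ge 1$) is the parity of the number of 1's in the binary expansion of $i-1$. A $k$-anti-power is a word of the form $w^{(1)}w^{(2)}\cdots w^{(k)}$ where $w^{(1)},\dots,w^{(k)}$ are pairwise distinct words of the same length. For $j\ge 0$, the $j$-fix of $\mathbf{t}$ of length $N$ is the word $\mathbf{t}_{j+1}\mathbf{t}_{j+2}\cdots\mathbf{t}_{j+N}$. For $k\in\mathbb{Z}^+$, $AP_j(\mathbf{t},k)$ is the set of positive integers $m$ such that the $j$-fix of $\mathbf{t}$ of length $km$ is a $k$-anti-power; this set is nonempty for all $j\ge0$, $k\ge1$, and $\gamma_j(k)=\min AP_j(\mathbf{t},k)$. -}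

module Defs where

open import Data.Nat using (ℕ; zero; suc; _+_; _*_; _∸_; _≤_; _<_)
open import Data.Nat.DivMod using (_/_; _%_)
open import Data.Bool using (Bool; true; false; _xor_)
open import Data.List using (List; map; take; drop; length)
open import Data.List.Base using (upTo)
open import Data.Fin using (Fin; toℕ)
open import Data.Product using (_×_)
open import Data.Integer using (+_)
open import Data.Rational using (ℚ; 0ℚ)
import Data.Rational as Q
open import Relation.Binary.PropositionalEquality using (_≡_; _≢_)

-- Parity of the number of 1's in the binary expansion of n.
-- The first argument is fuel; n steps of halving always suffice to reach 0.
parityAux : ℕ → ℕ → Bool
parityAux zero    n = false
parityAux (suc f) n = (n % 2 Data.Nat.≡ᵇ 1) xor parityAux f (n / 2)

bitParity : ℕ → Bool
bitParity n = parityAux n n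

-- Thue–Morse letter t_i for i ≥ 1 : parity of popcount (i - 1).
thueMorse : ℕ → Bool
thueMorse i = bitParity (i ∸ 1)

fix : ℕ → ℕ → List Bool
fix j N = map (λ r → thueMorse (j + suc r)) (upTo N)

block : ℕ → ℕ → List Bool → List Bool
block m a w = take m (drop (a * m) w)

IsAntiPower : ℕ → ℕ → List Bool → Set
IsAntiPower k m w =
  (length w ≡ k * m) ×
  ((a b : Fin k) → a ≢ b → block m (toℕ a) w ≢ block m (toℕ b) w)

InAP : ℕ → ℕ → ℕ → Set
InAP j k m = (1 ≤ m) × IsAntiPower k m (fix j (k * m))

IsGamma : ℕ → ℕ → ℕ → Set
IsGamma j k m = InAP j k m × ((m' : ℕ) → m' < m → InAP j k m' → Data.Empty.⊥)
  where import Data.Empty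

-- the rational m / k (k = 0 mapped to 0; only used with k ≥ 1)
ratio : ℕ → ℕ → ℚ
ratio m zero    = 0ℚ
ratio m (suc k) = (+ m) Q./ (suc k)

module Submission where

-- Write t n = 𝐭_{n+1} (the parity of the binary digit sum of n).  The proof rests on
-- the self-similarity  t (x + q·2^S) = t q xor t x  for x < 2^S.
--
-- If 2^s ≥ m, a length-m factor of 𝐭 starting at position p is
-- determined by p mod 2^s together with t (p div 2^s) and t (p div 2^s + 1), so there
-- are at most 4·2^s of them.  Choosing m ≤ 2^s ≤ 2m, every k-anti-power with blocks of
-- length m has k ≤ 8m; hence γ_j(k)/k ≥ 1/8, which gives the lim inf bound.
--
-- For d ≥ 1 the sequence x ↦ t x xor t (x + d) is not constant on any
-- interval [u, (4u+2)d].  For m = 2^S + 1 with S large the a-th and (a+d)-th blocks of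
-- the j-fix agree with t x and t (x + d) up to constant flips, so they differ: AP_j(t,k)
-- is nonempty and γ_j(k) exists as the least element of a decidable set.
--
-- The lim sup bound.  For k = 5·2^K, a block length m ≤ 2^K would force k ≤ 4·2^K, so
-- γ_j(k) > 2^K = k/5.

open import Defs
open import Data.Nat
  using (ℕ; zero; suc; _+_; _*_; _∸_; _^_; _≤_; _<_; _≡ᵇ_; z≤n; s≤s; NonZero; _≟_; _≤?_; _<?_)
open import Data.Nat.Properties
open import Data.Nat.DivMod using (m≡m%n+[m/n]*n; m%n<n; m*n%n≡0; m*n/n≡m; m/n<m; +-distrib-/; [m+kn]%n≡m%n)
  renaming (_/_ to _div_; _%_ to _mod_)
open import Data.Nat.Induction using (<-wellFounded)
open import Data.Nat.Tactic.RingSolver using (solve-∀)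
open import Data.Bool using (Bool; true; false; _xor_; not)
open import Data.Bool.Properties
  using (not-distribʳ-xor; xor-identityʳ; xor-same; xor-inverseˡ; xor-inverseʳ; not-injective)
import Data.Bool.Properties as BoolP
open import Data.List using (List; _∷_; take; drop; length; applyUpTo; upTo)
open import Data.List.Properties using (∷-injective; map-upTo; length-map; length-upTo; ≡-dec)
open import Data.Fin using (Fin; toℕ; fromℕ<; combine)
import Data.Fin as Fin
import Data.Fin.Properties as FinP
open import Data.Product using (Σ; _×_; _,_; proj₁; proj₂)
open import Data.Sum using (inj₁; inj₂)
open import Data.Empty using (⊥; ⊥-elim)
open import Induction.WellFounded using (Acc; acc)
open import Relation.Nullary using (Dec; yes; no)
open import Relation.Nullary.Decidable using (_×-dec_; _→-dec_; ¬?)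
open import Relation.Binary using (tri<; tri≈; tri>)
open import Relation.Binary.PropositionalEquality
open import Data.Integer using (+_; +≤+)
import Data.Integer as ℤ
import Data.Integer.Properties as ℤP
open import Data.Rational using (ℚ; 0ℚ; _/_; _-_) renaming (_<_ to _<ℚ_; _≤_ to _≤ℚ_)
import Data.Rational.Properties as ℚP
open import Data.Rational.Unnormalised using (mkℚᵘ; *≤*) renaming (_≤_ to _≤ᵘ_)
import Data.Rational.Unnormalised.Properties as ℚᵘP

-- t n is the letter 𝐭_{n+1}; positions in the j-fix start at t j.
t : ℕ → Bool
t = bitParity

parityAux-zero : ∀ f → parityAux f 0 ≡ false
parityAux-zero zero    = refl
parityAux-zero (suc f) = parityAux-zero f

half-≤ : ∀ n f → n ≤ suc f → n div 2 ≤ f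
half-≤ zero    f _       = z≤n
half-≤ (suc n) f (s≤s p) = ≤-trans (≤-pred (m/n<m (suc n) 2 (s≤s (s≤s z≤n)))) p

parityAux-fuel : ∀ f g n → n ≤ f → n ≤ g → parityAux f n ≡ parityAux g n
parityAux-fuel zero    g       .0 z≤n _   = sym (parityAux-zero g)
parityAux-fuel (suc f) zero    .0 z≤n z≤n = parityAux-zero (suc f)
parityAux-fuel (suc f) (suc g) n  p   q   =
  cong ((n mod 2 ≡ᵇ 1) xor_) (parityAux-fuel f g (n div 2) (half-≤ n f p) (half-≤ n g q))

t-step : ∀ n → t n ≡ ((n mod 2 ≡ᵇ 1) xor t (n div 2))
t-step zero    = refl
t-step (suc n) = cong ((suc n mod 2 ≡ᵇ 1) xor_)
  (parityAux-fuel n (suc n div 2) (suc n div 2) (half-≤ (suc n) n ≤-refl) ≤-refl)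

t-double : ∀ n → t (n * 2) ≡ t n
t-double n = begin
  t (n * 2)                                        ≡⟨ t-step (n * 2) ⟩
  ((n * 2 mod 2 ≡ᵇ 1) xor t (n * 2 div 2))         ≡⟨ cong (λ r → (r ≡ᵇ 1) xor t (n * 2 div 2)) (m*n%n≡0 n 2) ⟩
  t (n * 2 div 2)                                  ≡⟨ cong t (m*n/n≡m n 2) ⟩
  t n                                              ∎
  where open ≡-Reasoning

t-odd : ∀ n → t (1 + n * 2) ≡ not (t n)
t-odd n = begin
  t (1 + n * 2)                                    ≡⟨ t-step (1 + n * 2) ⟩
  (((1 + n * 2) mod 2 ≡ᵇ 1) xor t ((1 + n * 2) div 2))
    ≡⟨ cong (λ r → (r ≡ᵇ 1) xor t ((1 + n * 2) div 2)) ([m+kn]%n≡m%n 1 n 2) ⟩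
  not (t ((1 + n * 2) div 2))                      ≡⟨ cong (λ r → not (t r)) half-odd ⟩
  not (t n)                                        ∎
  where
  open ≡-Reasoning
  half-odd : (1 + n * 2) div 2 ≡ n
  half-odd = trans (+-distrib-/ 1 (n * 2) (subst (λ r → 1 + r < 2) (sym (m*n%n≡0 n 2)) ≤-refl)) (m*n/n≡m n 2)

data Parity : ℕ → Set where
  even : ∀ h → Parity (h * 2)
  odd  : ∀ h → Parity (1 + h * 2)

parity : ∀ n → Parity n
parity zero = even 0
parity (suc n) with parity n
... | even h = odd h
... | odd h  = even (suc h)

regroup : ∀ r h q P → r + h * 2 + q * (2 * P) ≡ r + (h + q * P) * 2
regroup = solve-∀

half-< : ∀ h P → h * 2 < 2 * P → h < P
half-< h P lt = *-cancelʳ-< 2 h P (subst (h * 2 <_) (*-comm 2 P) lt)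

t-block : ∀ S q x → x < 2 ^ S → t (x + q * 2 ^ S) ≡ (t q xor t x)
t-block zero q zero _ = trans (cong t (*-identityʳ q)) (sym (xor-identityʳ (t q)))
t-block zero q (suc x) (s≤s ())
t-block (suc S) q x x< with parity x
... | even h = begin
  t (h * 2 + q * 2 ^ suc S)      ≡⟨ cong t (regroup 0 h q (2 ^ S)) ⟩
  t ((h + q * 2 ^ S) * 2)        ≡⟨ t-double (h + q * 2 ^ S) ⟩
  t (h + q * 2 ^ S)              ≡⟨ t-block S q h (half-< h (2 ^ S) x<) ⟩
  (t q xor t h)                  ≡⟨ cong (t q xor_) (sym (t-double h)) ⟩
  (t q xor t (h * 2))            ∎
  where open ≡-Reasoning
... | odd h = begin
  t (1 + h * 2 + q * 2 ^ suc S)  ≡⟨ cong t (regroup 1 h q (2 ^ S)) ⟩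
  t (1 + (h + q * 2 ^ S) * 2)    ≡⟨ t-odd (h + q * 2 ^ S) ⟩
  not (t (h + q * 2 ^ S))        ≡⟨ cong not (t-block S q h (half-< h (2 ^ S) (≤-trans (n≤1+n _) x<))) ⟩
  not (t q xor t h)              ≡⟨ not-distribʳ-xor (t q) (t h) ⟩
  (t q xor not (t h))            ≡⟨ cong (t q xor_) (sym (t-odd h)) ⟩
  (t q xor t (1 + h * 2))        ∎
  where open ≡-Reasoning

applyUpTo-cong : ∀ {A : Set} (f g : ℕ → A) n → (∀ i → i < n → f i ≡ g i) →
                 applyUpTo f n ≡ applyUpTo g n
applyUpTo-cong f g zero    _  = refl
applyUpTo-cong f g (suc n) eq =
  cong₂ _∷_ (eq 0 (s≤s z≤n))
            (applyUpTo-cong (λ i → f (suc i)) (λ i → g (suc i)) n (λ i i< → eq (suc i) (s≤s i<)))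

applyUpTo-injective : ∀ {A : Set} (f g : ℕ → A) n → applyUpTo f n ≡ applyUpTo g n →
                      ∀ i → i < n → f i ≡ g i
applyUpTo-injective f g (suc n) eq zero    _       = proj₁ (∷-injective eq)
applyUpTo-injective f g (suc n) eq (suc i) (s≤s i<) =
  applyUpTo-injective (λ i → f (suc i)) (λ i → g (suc i)) n (proj₂ (∷-injective eq)) i i<

drop-applyUpTo : ∀ {A : Set} (f : ℕ → A) n p → drop n (applyUpTo f (n + p)) ≡ applyUpTo (λ i → f (n + i)) p
drop-applyUpTo f zero    p = refl
drop-applyUpTo f (suc n) p = drop-applyUpTo (λ i → f (suc i)) n p

take-applyUpTo : ∀ {A : Set} (f : ℕ → A) n p → take n (applyUpTo f (n + p)) ≡ applyUpTo f n
take-applyUpTo f zero    p = refl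
take-applyUpTo f (suc n) p = cong (f 0 ∷_) (take-applyUpTo (λ i → f (suc i)) n p)

fix-applyUpTo : ∀ j N → fix j N ≡ applyUpTo (λ r → t (j + r)) N
fix-applyUpTo j N = trans (map-upTo _ N)
  (applyUpTo-cong _ _ N (λ i _ → cong (λ p → bitParity (p ∸ 1)) (+-suc j i)))

length-fix : ∀ j N → length (fix j N) ≡ N
length-fix j N = trans (length-map _ (upTo N)) (length-upTo N)

block-fix : ∀ j k m a → a < k → block m a (fix j (k * m)) ≡ applyUpTo (λ i → t (j + (a * m + i))) m
block-fix j k m a a<k = begin
  take m (drop (a * m) (fix j (k * m)))
    ≡⟨ cong (λ w → take m (drop (a * m) w)) (fix-applyUpTo j (k * m)) ⟩
  take m (drop (a * m) (applyUpTo letter (k * m)))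
    ≡⟨ cong (λ n → take m (drop (a * m) (applyUpTo letter n))) length-split ⟩
  take m (drop (a * m) (applyUpTo letter (a * m + (m + c * m))))
    ≡⟨ cong (take m) (drop-applyUpTo letter (a * m) (m + c * m)) ⟩
  take m (applyUpTo (λ i → letter (a * m + i)) (m + c * m))
    ≡⟨ take-applyUpTo _ m (c * m) ⟩
  applyUpTo (λ i → t (j + (a * m + i))) m
    ∎
  where
  open ≡-Reasoning
  letter : ℕ → Bool
  letter r = t (j + r)
  c : ℕ
  c = k ∸ suc a
  split : ∀ a c m → suc (a + c) * m ≡ a * m + (m + c * m)
  split = solve-∀
  length-split : k * m ≡ a * m + (m + c * m)
  length-split = trans (cong (_* m) (sym (m+[n∸m]≡n a<k))) (split a c m)

module _ (j k m : ℕ) {a b : ℕ} (a<k : a < k) (b<k : b < k) where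

  blocks-equal⇒letters-equal : block m a (fix j (k * m)) ≡ block m b (fix j (k * m)) →
    ∀ i → i < m → t (j + (a * m + i)) ≡ t (j + (b * m + i))
  blocks-equal⇒letters-equal eq = applyUpTo-injective _ _ m
    (trans (sym (block-fix j k m a a<k)) (trans eq (block-fix j k m b b<k)))

  letters-equal⇒blocks-equal : (∀ i → i < m → t (j + (a * m + i)) ≡ t (j + (b * m + i))) →
    block m a (fix j (k * m)) ≡ block m b (fix j (k * m))
  letters-equal⇒blocks-equal eq =
    trans (block-fix j k m a a<k) (trans (applyUpTo-cong _ _ m eq) (sym (block-fix j k m b b<k)))

-- Counting factors: at most 4·2^s distinct factors of length m ≤ 2^s.

t-twoBlocks : ∀ S q q' y → y < 2 ^ S + 2 ^ S → t q ≡ t q' → t (suc q) ≡ t (suc q') →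
              t (y + q * 2 ^ S) ≡ t (y + q' * 2 ^ S)
t-twoBlocks S q q' y y< tq≡ tq+1≡ with y <? 2 ^ S
... | yes y<N = begin
  t (y + q * 2 ^ S)    ≡⟨ t-block S q y y<N ⟩
  (t q xor t y)        ≡⟨ cong (_xor t y) tq≡ ⟩
  (t q' xor t y)       ≡⟨ t-block S q' y y<N ⟨
  t (y + q' * 2 ^ S)   ∎
  where open ≡-Reasoning
... | no y≮N = begin
  t (y + q * 2 ^ S)          ≡⟨ cong t (carry q) ⟩
  t (x + suc q * 2 ^ S)      ≡⟨ t-block S (suc q) x x<N ⟩
  (t (suc q) xor t x)        ≡⟨ cong (_xor t x) tq+1≡ ⟩
  (t (suc q') xor t x)       ≡⟨ t-block S (suc q') x x<N ⟨
  t (x + suc q' * 2 ^ S)     ≡⟨ cong t (carry q') ⟨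
  t (y + q' * 2 ^ S)         ∎
  where
  open ≡-Reasoning
  N : ℕ
  N = 2 ^ S
  x : ℕ
  x = y ∸ N
  y≡N+x : N + x ≡ y
  y≡N+x = m+[n∸m]≡n (≮⇒≥ y≮N)
  x<N : x < N
  x<N = +-cancelˡ-< N x N (subst (_< N + N) (sym y≡N+x) y<)
  reassoc : ∀ N x r → N + x + r * N ≡ x + (N + r * N)
  reassoc = solve-∀
  carry : ∀ r → y + r * N ≡ x + suc r * N
  carry r = trans (cong (_+ r * N) (sym y≡N+x)) (reassoc N x r)

-- Bits as elements of Fin 2, for encoding a block as an element of a finite set.
bool→fin : Bool → Fin 2
bool→fin false = Fin.zero
bool→fin true  = Fin.suc Fin.zero

bool→fin-injective : ∀ x y → bool→fin x ≡ bool→fin y → x ≡ y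
bool→fin-injective false false _ = refl
bool→fin-injective true  true  _ = refl

module FactorCount (j k m s : ℕ) (m≤2^s : m ≤ 2 ^ s) where

  N : ℕ
  N = 2 ^ s

  instance
    N-nonZero : NonZero N
    N-nonZero = m^n≢0 2 s

  start : Fin k → ℕ
  start a = j + toℕ a * m

  -- The a-th block is determined by its start modulo N and the letters of 𝐭
  -- indexing the two N-blocks it meets.
  offset : Fin k → Fin N
  offset a = fromℕ< (m%n<n (start a) N)

  bit : Fin k → ℕ → Fin 2
  bit a δ = bool→fin (t (δ + start a div N))

  code : Fin k → Fin (N * 2 * 2)
  code a = combine (combine (offset a) (bit a 0)) (bit a 1)

  decompose : ∀ a i → j + (toℕ a * m + i) ≡ (start a mod N + i) + start a div N * N
  decompose a i = begin
    j + (toℕ a * m + i)                         ≡⟨ +-assoc j (toℕ a * m) i ⟨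
    start a + i                                 ≡⟨ cong (_+ i) (m≡m%n+[m/n]*n (start a) N) ⟩
    start a mod N + start a div N * N + i       ≡⟨ swap (start a mod N) (start a div N * N) i ⟩
    start a mod N + i + start a div N * N       ∎
    where
    open ≡-Reasoning
    swap : ∀ r p i → r + p + i ≡ r + i + p
    swap = solve-∀

  code-determines-block : ∀ a b → code a ≡ code b →
    block m (toℕ a) (fix j (k * m)) ≡ block m (toℕ b) (fix j (k * m))
  code-determines-block a b eq =
    letters-equal⇒blocks-equal j k m (FinP.toℕ<n a) (FinP.toℕ<n b) same-letter
    where
    outer : combine (offset a) (bit a 0) ≡ combine (offset b) (bit b 0) × bit a 1 ≡ bit b 1
    outer = FinP.combine-injective _ _ _ _ eq
    inner : offset a ≡ offset b × bit a 0 ≡ bit b 0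
    inner = FinP.combine-injective _ _ _ _ (proj₁ outer)
    same-offset : start a mod N ≡ start b mod N
    same-offset = trans (sym (FinP.toℕ-fromℕ< _)) (trans (cong toℕ (proj₁ inner)) (FinP.toℕ-fromℕ< _))
    same-letter : ∀ i → i < m → t (j + (toℕ a * m + i)) ≡ t (j + (toℕ b * m + i))
    same-letter i i<m = begin
      t (j + (toℕ a * m + i))                        ≡⟨ cong t (decompose a i) ⟩
      t (start a mod N + i + start a div N * N)      ≡⟨ cong (λ r → t (r + i + start a div N * N)) same-offset ⟩
      t (start b mod N + i + start a div N * N)
        ≡⟨ t-twoBlocks s (start a div N) (start b div N) (start b mod N + i)
             (+-mono-< (m%n<n (start b) N) (≤-trans i<m m≤2^s))
             (bool→fin-injective _ _ (proj₂ inner)) (bool→fin-injective _ _ (proj₂ outer)) ⟩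
      t (start b mod N + i + start b div N * N)      ≡⟨ cong t (decompose b i) ⟨
      t (j + (toℕ b * m + i))                        ∎
      where open ≡-Reasoning

  -- Pigeonhole: more than 4N blocks cannot be pairwise distinct.
  antiPower-bound : IsAntiPower k m (fix j (k * m)) → k ≤ N * 2 * 2
  antiPower-bound (_ , distinct) with k ≤? N * 2 * 2
  ... | yes k≤ = k≤
  ... | no k≰ with FinP.pigeonhole (≰⇒> k≰) code
  ...   | a , b , a<b , eq = ⊥-elim (distinct a b (FinP.<⇒≢ a<b) (code-determines-block a b eq))

-- Existence of anti-powers.

xor-cancel : ∀ a b x y → (a xor x) ≡ (b xor y) → (x xor y) ≡ (a xor b)
xor-cancel false false x .x refl = xor-same x
xor-cancel false true  .(not y) y refl = xor-inverseˡ y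
xor-cancel true  false x .(not x) refl = xor-inverseʳ x
xor-cancel true  true  x y eq with refl ← not-injective eq = xor-same x

DifferenceChanges : ℕ → ℕ → Set
DifferenceChanges d u = Σ ℕ λ x₁ → Σ ℕ λ x₂ →
  u ≤ x₁ × x₁ ≤ x₂ × x₂ + d ≤ (4 * u + 2) * d × (t x₁ xor t (x₁ + d)) ≢ (t x₂ xor t (x₂ + d))

-- Odd shifts: at x = 2n and 2n+1 with n = 2u+h the two differences are complementary.
differenceChanges-odd : ∀ h u → DifferenceChanges (1 + h * 2) u
differenceChanges-odd h u =
  n * 2 , 1 + n * 2 ,
  subst (u ≤_) (sym (e₁ u h)) (m≤m+n u (u * 3 + h * 2)) ,
  n≤1+n (n * 2) ,
  subst (1 + n * 2 + (1 + h * 2) ≤_) (sym (e₂ u h)) (m≤m+n _ (u * h * 8)) ,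
  λ eq → flip (t n) (t (u + h)) (trans (sym at-even) (trans eq at-odd))
  where
  n : ℕ
  n = u * 2 + h
  e₁ : ∀ u h → (u * 2 + h) * 2 ≡ u + (u * 3 + h * 2)
  e₁ = solve-∀
  e₂ : ∀ u h → (4 * u + 2) * (1 + h * 2) ≡ (1 + (u * 2 + h) * 2 + (1 + h * 2)) + u * h * 8
  e₂ = solve-∀
  e₃ : ∀ u h → (u * 2 + h) * 2 + (1 + h * 2) ≡ 1 + ((u + h) * 2) * 2
  e₃ = solve-∀
  e₄ : ∀ u h → 1 + (u * 2 + h) * 2 + (1 + h * 2) ≡ (1 + (u + h) * 2) * 2
  e₄ = solve-∀
  flip : ∀ α β → (α xor not β) ≢ (not α xor not β)
  flip true  true  ()
  flip true  false ()
  flip false true  ()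
  flip false false ()
  at-even : (t (n * 2) xor t (n * 2 + (1 + h * 2))) ≡ (t n xor not (t (u + h)))
  at-even = cong₂ _xor_ (t-double n)
    (trans (cong t (e₃ u h)) (trans (t-odd ((u + h) * 2)) (cong not (t-double (u + h)))))
  at-odd : (t (1 + n * 2) xor t (1 + n * 2 + (1 + h * 2))) ≡ (not (t n) xor not (t (u + h)))
  at-odd = cong₂ _xor_ (t-odd n) (trans (cong t (e₄ u h)) (trans (t-double (1 + (u + h) * 2)) (t-odd (u + h))))

-- Even shifts: doubling both points transports a witness for h to one for 2h.
differenceChanges-double : ∀ h u → DifferenceChanges h u → DifferenceChanges (h * 2) u
differenceChanges-double h u (y₁ , y₂ , u≤y₁ , y₁≤y₂ , y₂+h≤ , differ) =
  y₁ * 2 , y₂ * 2 , ≤-trans u≤y₁ (m≤m*n y₁ 2) , *-monoˡ-≤ 2 y₁≤y₂ ,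
  subst₂ _≤_ (sym (e₁ y₂ h)) (e₂ u h) (*-monoˡ-≤ 2 y₂+h≤) ,
  λ eq → differ (trans (sym (doubled y₁)) (trans eq (doubled y₂)))
  where
  e₁ : ∀ y h → y * 2 + h * 2 ≡ (y + h) * 2
  e₁ = solve-∀
  e₂ : ∀ u h → (4 * u + 2) * h * 2 ≡ (4 * u + 2) * (h * 2)
  e₂ = solve-∀
  doubled : ∀ y → (t (y * 2) xor t (y * 2 + h * 2)) ≡ (t y xor t (y + h))
  doubled y = cong₂ _xor_ (t-double y) (trans (cong t (e₁ y h)) (t-double (y + h)))

differenceChanges : ∀ d u → 1 ≤ d → DifferenceChanges d u
differenceChanges d u = go d (<-wellFounded d)
  where
  go : ∀ d → Acc _<_ d → 1 ≤ d → DifferenceChanges d u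
  go d rec 1≤d with parity d
  go .(1 + h * 2) _         _   | odd h  = differenceChanges-odd h u
  go .(h * 2)     (acc rec) 1≤d | even h =
    differenceChanges-double h u (go h (rec (half<double h 1≤d)) (half-positive h 1≤d))
    where
    half-positive : ∀ h → 1 ≤ h * 2 → 1 ≤ h
    half-positive (suc _) _ = s≤s z≤n
    half<double : ∀ h → 1 ≤ h * 2 → h < h * 2
    half<double (suc h) _ = m<m*n (suc h) 2 (s≤s (s≤s z≤n))

n<2^n : ∀ n → n < 2 ^ n
n<2^n zero    = s≤s z≤n
n<2^n (suc n) = begin
  1 + suc n         ≡⟨ +-comm 1 (suc n) ⟩
  suc n + 1         ≤⟨ +-mono-≤ (n<2^n n) (m^n>0 2 n) ⟩
  2 ^ n + 2 ^ n     ≡⟨ cong (λ r → 2 ^ n + r) (+-identityʳ (2 ^ n)) ⟨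
  2 ^ suc n         ∎
  where open ≤-Reasoning

module AntiPowerExists (j k : ℕ) where

  S : ℕ
  S = (4 * (j + k) + 2) * k

  N : ℕ
  N = 2 ^ S

  m : ℕ
  m = suc N

  F : List Bool
  F = fix j (k * m)

  block-letter : ∀ c r → j + c + r < N → t (j + (c * m + r)) ≡ (t c xor t (j + c + r))
  block-letter c r lt = trans (cong t (position j c N r)) (t-block S c (j + c + r) lt)
    where
    position : ∀ j c N r → j + (c * suc N + r) ≡ j + c + r + c * N
    position = solve-∀

  blocks-distinct : ∀ a d → 1 ≤ d → a + d < k → block m a F ≢ block m (a + d) F
  blocks-distinct a d 1≤d a+d<k eq with differenceChanges d (j + a) 1≤d
  ... | x₁ , x₂ , u≤x₁ , x₁≤x₂ , x₂+d≤ , differ =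
    differ (trans (constant x₁ u≤x₁ x₁+d<N) (sym (constant x₂ (≤-trans u≤x₁ x₁≤x₂) x₂+d<N)))
    where
    a<k : a < k
    a<k = ≤-<-trans (m≤m+n a d) a+d<k
    x₂+d<N : x₂ + d < N
    x₂+d<N = ≤-<-trans (≤-trans x₂+d≤ (*-mono-≤ (+-monoˡ-≤ 2 (*-monoʳ-≤ 4 (+-monoʳ-≤ j (<⇒≤ a<k))))
                                                 (≤-trans (m≤n+m d a) (<⇒≤ a+d<k))))
                        (n<2^n S)
    x₁+d<N : x₁ + d < N
    x₁+d<N = ≤-<-trans (+-monoˡ-≤ d x₁≤x₂) x₂+d<N
    shift : ∀ j a d r → j + (a + d) + r ≡ j + a + r + d
    shift = solve-∀
    -- Equal blocks force t x xor t (x + d) to be constant on the relevant range.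
    constant : ∀ x → j + a ≤ x → x + d < N → (t x xor t (x + d)) ≡ (t a xor t (a + d))
    constant x u≤x x+d<N = xor-cancel (t a) (t (a + d)) (t x) (t (x + d)) (begin
      (t a xor t x)                       ≡⟨ cong (λ y → t a xor t y) x≡ ⟨
      (t a xor t (j + a + r))             ≡⟨ block-letter a r (subst (_< N) (sym x≡) x<N) ⟨
      t (j + (a * m + r))                 ≡⟨ blocks-equal⇒letters-equal j k m a<k a+d<k eq r r<m ⟩
      t (j + ((a + d) * m + r))           ≡⟨ block-letter (a + d) r (subst (_< N) (sym x+d≡) x+d<N) ⟩
      (t (a + d) xor t (j + (a + d) + r)) ≡⟨ cong (λ y → t (a + d) xor t y) x+d≡ ⟩
      (t (a + d) xor t (x + d))           ∎)
      where
      open ≡-Reasoning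
      r : ℕ
      r = x ∸ (j + a)
      x≡ : j + a + r ≡ x
      x≡ = m+[n∸m]≡n u≤x
      x+d≡ : j + (a + d) + r ≡ x + d
      x+d≡ = trans (shift j a d r) (cong (_+ d) x≡)
      x<N : x < N
      x<N = ≤-<-trans (m≤m+n x d) x+d<N
      r<m : r < m
      r<m = s≤s (≤-trans (m∸n≤m x (j + a)) (<⇒≤ x<N))

  antiPower : InAP j k m
  antiPower = s≤s z≤n , length-fix j (k * m) , distinct
    where
    ordered : ∀ {a b} → a < b → b < k → block m a F ≢ block m b F
    ordered {a} {b} a<b b<k = subst (λ c → block m a F ≢ block m c F) (m+[n∸m]≡n (<⇒≤ a<b))
      (blocks-distinct a (b ∸ a) (m<n⇒0<n∸m a<b) (subst (_< k) (sym (m+[n∸m]≡n (<⇒≤ a<b))) b<k))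
    distinct : (a b : Fin k) → a ≢ b → block m (toℕ a) F ≢ block m (toℕ b) F
    distinct a b a≢b with <-cmp (toℕ a) (toℕ b)
    ... | tri< a<b _ _ = ordered a<b (FinP.toℕ<n b)
    ... | tri≈ _ a≡b _ = ⊥-elim (a≢b (FinP.toℕ-injective a≡b))
    ... | tri> _ _ b<a = λ eq → ordered b<a (FinP.toℕ<n a) (sym eq)

Least : (ℕ → Set) → ℕ → Set
Least P m = P m × ((m' : ℕ) → m' < m → P m' → ⊥)

least : (P : ℕ → Set) → (∀ n → Dec (P n)) → ∀ {M} → P M → Σ ℕ (Least P)
least P P? {M} pM = search M 0 (+-identityʳ M) (λ _ ())
  where
  -- Scan n = 0, 1, …; the fuel f = M − n bounds the search since P M holds.
  search : ∀ f n → f + n ≡ M → ((m' : ℕ) → m' < n → P m' → ⊥) → Σ ℕ (Least P)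
  search f n f+n≡M below with P? n
  ... | yes pn = n , pn , below
  search zero    n f+n≡M below | no ¬pn = ⊥-elim (¬pn (subst P (sym f+n≡M) pM))
  search (suc f) n f+n≡M below | no ¬pn = search f (suc n) (trans (+-suc f n) f+n≡M) below′
    where
    below′ : (m' : ℕ) → m' < suc n → P m' → ⊥
    below′ m' m'<1+n pm' with m<1+n⇒m<n∨m≡n m'<1+n
    ... | inj₁ m'<n  = below m' m'<n pm'
    ... | inj₂ refl = ¬pn pm'

inAP? : ∀ j k m → Dec (InAP j k m)
inAP? j k m = (1 ≤? m) ×-dec ((length (fix j (k * m)) ≟ k * m) ×-dec
  FinP.all? (λ a → FinP.all? (λ b → ¬? (a FinP.≟ b) →-dec ¬? (≡-dec BoolP._≟_ _ _))))

gamma : ∀ j k → Σ ℕ (IsGamma j k)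
gamma j k = least (InAP j k) (inAP? j k) (AntiPowerExists.antiPower j k)

powerOfTwo-between : ∀ m → 1 ≤ m → Σ ℕ λ s → m ≤ 2 ^ s × 2 ^ s ≤ 2 * m
powerOfTwo-between m 1≤m with least (λ s → m ≤ 2 ^ s) (λ s → m ≤? 2 ^ s) {m} (<⇒≤ (n<2^n m))
... | s , m≤2^s , smaller = s , m≤2^s , tight s smaller
  where
  tight : ∀ s → ((s' : ℕ) → s' < s → m ≤ 2 ^ s' → ⊥) → 2 ^ s ≤ 2 * m
  tight zero     _       = ≤-trans 1≤m (m≤m+n m (m + 0))
  tight (suc s') smaller = *-monoʳ-≤ 2 (<⇒≤ (≰⇒> (smaller s' ≤-refl)))

antiPower-length-bound : ∀ {j k m} → InAP j k m → k ≤ m * 8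
antiPower-length-bound {j} {k} {m} (1≤m , antiPower) with powerOfTwo-between m 1≤m
... | s , m≤2^s , 2^s≤2m = begin
  k                 ≤⟨ FactorCount.antiPower-bound j k m s m≤2^s antiPower ⟩
  2 ^ s * 2 * 2     ≤⟨ *-monoˡ-≤ 2 (*-monoˡ-≤ 2 2^s≤2m) ⟩
  2 * m * 2 * 2     ≡⟨ eight m ⟩
  m * 8             ∎
  where
  open ≤-Reasoning
  eight : ∀ m → 2 * m * 2 * 2 ≡ m * 8
  eight = solve-∀

ratio-lowerBound : ∀ c m k → suc k ≤ m * suc c → (+ 1) / suc c ≤ℚ ratio m (suc k)
ratio-lowerBound c m k k≤ = ℚP.toℚᵘ-cancel-≤
  (ℚᵘP.≤-respˡ-≃ (ℚᵘP.≃-sym (ℚP.toℚᵘ-fromℚᵘ (mkℚᵘ (+ 1) c)))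
  (ℚᵘP.≤-respʳ-≃ (ℚᵘP.≃-sym (ℚP.toℚᵘ-fromℚᵘ (mkℚᵘ (+ m) k))) cross-multiplied))
  where
  cross-multiplied : mkℚᵘ (+ 1) c ≤ᵘ mkℚᵘ (+ m) k
  cross-multiplied = *≤* (subst₂ ℤ._≤_ (ℤP.pos-* 1 (suc k)) (ℤP.pos-* m (suc c))
    (+≤+ (subst (_≤ m * suc c) (sym (*-identityˡ (suc k))) k≤)))

minus-positive : ∀ q ε → 0ℚ <ℚ ε → q - ε <ℚ q
minus-positive q ε 0<ε = subst (q - ε <ℚ_) (ℚP.+-identityʳ q) (ℚP.+-monoʳ-< q (ℚP.neg-antimono-< 0<ε))

ratio-above : ∀ c m k ε → 0ℚ <ℚ ε → 1 ≤ k → k ≤ m * suc c → ((+ 1) / suc c) - ε <ℚ ratio m k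
ratio-above c m (suc k) ε 0<ε _ k≤ = ℚP.<-≤-trans (minus-positive _ ε 0<ε) (ratio-lowerBound c m k k≤)

-- For k = 5·2^K every block length m ≤ 2^K is too short, so every m ∈ AP_j(t,k)
-- exceeds 2^K = k/5.
gamma-large : ∀ j K m → InAP j (2 ^ K * 5) m → 2 ^ K * 5 ≤ m * 5
gamma-large j K m (_ , antiPower) with m ≤? 2 ^ K
... | no m≰2^K = *-monoˡ-≤ 5 (<⇒≤ (≰⇒> m≰2^K))
... | yes m≤2^K = ⊥-elim (<⇒≱ four<five (FactorCount.antiPower-bound j (2 ^ K * 5) m K m≤2^K antiPower))
  where
  four<five : 2 ^ K * 2 * 2 < 2 ^ K * 5
  four<five = subst₂ _<_ (sym (*-assoc (2 ^ K) 2 2)) refl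
    (*-monoʳ-< (2 ^ K) {{m^n≢0 2 K}} (s≤s (s≤s (s≤s (s≤s (s≤s z≤n))))))

mainTheorem1 : (j : ℕ) →
    ((ε : ℚ) → 0ℚ <ℚ ε → Σ ℕ λ K → (k : ℕ) → 1 ≤ k → K ≤ k → (m : ℕ) → IsGamma j k m →
        ((+ 1) / 10) - ε ≤ℚ ratio m k)
    × ((ε : ℚ) → 0ℚ <ℚ ε → (K : ℕ) → Σ ℕ λ k → 1 ≤ k × K ≤ k × Σ ℕ λ m → IsGamma j k m ×
        (((+ 1) / 5) - ε <ℚ ratio m k))
mainTheorem1 j = liminf , limsup
  where
  -- Every k ≥ 1 works: k ≤ 8m ≤ 10m.
  liminf : (ε : ℚ) → 0ℚ <ℚ ε → Σ ℕ λ K → (k : ℕ) → 1 ≤ k → K ≤ k → (m : ℕ) → IsGamma j k m →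
           ((+ 1) / 10) - ε ≤ℚ ratio m k
  liminf ε 0<ε = 0 , λ k 1≤k _ m (inAP , _) → ℚP.<⇒≤ (ratio-above 9 m k ε 0<ε 1≤k
    (≤-trans (antiPower-length-bound {j} inAP) (*-monoʳ-≤ m (m≤m+n 8 2))))
  limsup : (ε : ℚ) → 0ℚ <ℚ ε → (K : ℕ) → Σ ℕ λ k → 1 ≤ k × K ≤ k × Σ ℕ λ m → IsGamma j k m ×
           (((+ 1) / 5) - ε <ℚ ratio m k)
  limsup ε 0<ε K =
    k , 1≤k , K≤k , m , isGamma , ratio-above 4 m k ε 0<ε 1≤k (gamma-large j K m (proj₁ isGamma))
    where
    k : ℕ
    k = 2 ^ K * 5
    m : ℕ
    m = proj₁ (gamma j k)
    isGamma : IsGamma j k m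
    isGamma = proj₂ (gamma j k)
    K≤k : K ≤ k
    K≤k = ≤-trans (<⇒≤ (n<2^n K)) (m≤m*n (2 ^ K) 5)
    1≤k : 1 ≤ k
    1≤k = ≤-trans (m^n>0 2 K) (m≤m*n (2 ^ K) 5)
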